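{- Let $G$ be a graph, let $P$ be an isometric $(u,v)$-path in $G$, and let $e_0$ be any edge of $G$ incident to $u$. Then the vertices of $L(P)$ (that is, the edges of $P$, viewed as vertices of $L(G)$) can be covered by two $e_0$-rooted isometric paths of $L(G)$.
   Context: The line graph $L(G)$ has vertex set $E(G)$, two vertices adjacent iff the corresponding edges share an end-vertex. An isometric path is a shortest path between its end-vertices in the indicated graph; it is $x$-rooted if $x$ is one of its end-vertices. -}

module Defs where

open import Data.Nat using (ℕ; zero; suc; _≤_)
open import Data.Fin using (Fin; _<_)
open import Data.Bool using (Bool; true; false)
open import Data.Product using (Σ; _×_; _,_; proj₁)
open import Data.Sum using (_⊎_; inj₁; inj₂)
open import Data.Empty using (⊥)
open import Data.List using (List; []; _∷_)
open import Data.List.Relation.Unary.Unique.Propositional using (Unique)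
open import Relation.Nullary using (¬_)
open import Relation.Binary.PropositionalEquality using (_≡_; _≢_; refl; sym; trans)

record Graph : Set₁ where
  field
    V       : Set
    _~_     : V → V → Set
    ~-sym   : ∀ {x y} → x ~ y → y ~ x
    ~-irrefl : ∀ {x} → ¬ (x ~ x)

module _ (G : Graph) where
  open Graph G

  data Walk : V → V → Set where
    []  : ∀ {x} → Walk x x
    _∷_ : ∀ {x y z} → x ~ y → Walk y z → Walk x z

  length : ∀ {x y} → Walk x y → ℕ
  length []      = zero
  length (_ ∷ w) = suc (length w)

  vertices : ∀ {x y} → Walk x y → List V
  vertices ([] {x})      = x ∷ []
  vertices (_∷_ {x} _ w) = x ∷ vertices w

  edgePairs : ∀ {x y} → Walk x y → List (V × V)
  edgePairs []                  = []
  edgePairs (_∷_ {x} {y} _ w)   = (x , y) ∷ edgePairs w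

  IsPath : ∀ {x y} → Walk x y → Set
  IsPath w = Unique (vertices w)

  IsIsometric : ∀ {x y} → Walk x y → Set
  IsIsometric {x} {y} w = IsPath w × (∀ (w' : Walk x y) → length w ≤ length w')

record SimpleGraph (n : ℕ) : Set where
  field
    adj        : Fin n → Fin n → Bool
    adj-sym    : ∀ x y → adj x y ≡ adj y x
    adj-irrefl : ∀ x → adj x x ≡ false

module _ {n : ℕ} (G : SimpleGraph n) where
  open SimpleGraph G

  private
    true≢false : true ≢ false
    true≢false ()

  toGraph : Graph
  toGraph = record
    { V = Fin n
    ; _~_ = λ x y → adj x y ≡ true
    ; ~-sym = λ {x} {y} p → trans (adj-sym y x) p
    ; ~-irrefl = λ {x} p → true≢false (trans (sym p) (adj-irrefl x))
    }

  record Edge : Set where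
    constructor edge
    field
      lo hi    : Fin n
      lo<hi    : lo < hi
      adjacent : adj lo hi ≡ true
  open Edge public

  ShareEnd : Edge → Edge → Set
  ShareEnd e f = (lo e ≡ lo f ⊎ lo e ≡ hi f) ⊎ (hi e ≡ lo f ⊎ hi e ≡ hi f)

  private
    shareEnd-sym : ∀ {e f} → ShareEnd e f → ShareEnd f e
    shareEnd-sym (inj₁ (inj₁ p)) = inj₁ (inj₁ (sym p))
    shareEnd-sym (inj₁ (inj₂ p)) = inj₂ (inj₁ (sym p))
    shareEnd-sym (inj₂ (inj₁ p)) = inj₁ (inj₂ (sym p))
    shareEnd-sym (inj₂ (inj₂ p)) = inj₂ (inj₂ (sym p))

  LineGraph : Graph
  LineGraph = record
    { V = Edge
    ; _~_ = λ e f → e ≢ f × ShareEnd e f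
    ; ~-sym = λ { {e} {f} (ne , s) → (λ eq → ne (sym eq)) , shareEnd-sym {e} {f} s }
    ; ~-irrefl = λ p → proj₁ p refl
    }

  IncidentTo : Fin n → Edge → Set
  IncidentTo x e = x ≡ lo e ⊎ x ≡ hi e

  HasEnds : Edge → Fin n → Fin n → Set
  HasEnds e a b = (lo e ≡ a × hi e ≡ b) ⊎ (lo e ≡ b × hi e ≡ a)

-- Write P = x₀ x₁ … x_k with x₀ = u, and e₀ = u w. For distinct edges e, f of G the
-- distance in L(G) is 1 + min d(a, b) over end-vertices a of e and b of f, so an
-- L(G)-walk from e₀ whose length does not exceed that value is isometric. Let i be the
-- first index with d(w, x_i) < i. Then e₀, x₀x₁, …, x_{i-1}x_i is isometric in L(G),
-- and so is e₀ followed by the edges of a shortest (w, x_i)-path and then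
-- x_i x_{i+1}, …, x_{k-1}x_k; together they cover L(P). If there is no such i, the
-- first walk continued up to x_k is isometric and covers L(P) alone.
module Submission where

open import Defs
open import Data.Nat using (ℕ; zero; suc; _+_; _≤_; z≤n; s≤s)
open import Data.Nat.Properties
  using (≤-refl; ≤-trans; m≤n⇒m≤1+n; <⇒≤; ≤-pred; ≰⇒>; <-irrefl; +-suc; +-comm;
         +-mono-≤; +-monoʳ-≤; +-monoˡ-≤; +-cancelˡ-≤; +-cancelʳ-≤)
open import Data.Fin using (Fin)
open import Data.Fin.Properties using (<-cmp; <-irrelevant; any?) renaming (_≟_ to _≟ᶠ_)
open import Data.Bool using (true) renaming (_≟_ to _≟ᵇ_)
open import Data.Product using (Σ; _×_; _,_; proj₁; proj₂; map₂; uncurry)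
open import Data.Sum using (_⊎_; inj₁; inj₂)
open import Data.Empty using (⊥-elim)
open import Data.List using ([]; _∷_; _++_)
open import Data.List.Membership.Propositional using (_∈_)
open import Data.List.Membership.Propositional.Properties using (∈-++⁺ʳ; ∈-++⁻)
open import Data.List.Relation.Unary.Any using (here; there)
import Data.List.Relation.Unary.All as All
open import Data.List.Relation.Unary.AllPairs using ([]; _∷_)
open import Relation.Nullary using (Dec; yes; no)
open import Relation.Nullary.Decidable using (_×-dec_; map′)
open import Relation.Binary using (tri<; tri≈; tri>)
open import Relation.Binary.PropositionalEquality
open import Axiom.UniquenessOfIdentityProofs using (module Decidable⇒UIP)

module Walks (H : Graph) where
  open Graph H using (_~_)

  infixr 5 _++ʷ_
  _++ʷ_ : ∀ {x y z} → Walk H x y → Walk H y z → Walk H x z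
  []      ++ʷ W = W
  (s ∷ U) ++ʷ W = s ∷ (U ++ʷ W)

  ++ʷ-assoc : ∀ {w x y z} (U : Walk H w x) (V : Walk H x y) (W : Walk H y z) →
    (U ++ʷ V) ++ʷ W ≡ U ++ʷ (V ++ʷ W)
  ++ʷ-assoc []      V W = refl
  ++ʷ-assoc (s ∷ U) V W = cong (s ∷_) (++ʷ-assoc U V W)

  length-++ʷ : ∀ {x y z} (U : Walk H x y) (W : Walk H y z) →
    length H (U ++ʷ W) ≡ length H U + length H W
  length-++ʷ []      W = refl
  length-++ʷ (s ∷ U) W = cong suc (length-++ʷ U W)

  length-snoc : ∀ {x y z} (U : Walk H x y) (s : y ~ z) →
    length H (U ++ʷ s ∷ []) ≡ suc (length H U)
  length-snoc []      s = refl
  length-snoc (r ∷ U) s = cong suc (length-snoc U s)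

  edgePairs-++ʷ : ∀ {x y z} (U : Walk H x y) (W : Walk H y z) →
    edgePairs H (U ++ʷ W) ≡ edgePairs H U ++ edgePairs H W
  edgePairs-++ʷ []      W = refl
  edgePairs-++ʷ (s ∷ U) W = cong (_ ∷_) (edgePairs-++ʷ U W)

  WalkWithin : ℕ → Graph.V H → Graph.V H → Set
  WalkWithin l x y = Σ (Walk H x y) λ W → length H W ≤ l

  WalksAtLeast : ℕ → Graph.V H → Graph.V H → Set
  WalksAtLeast d x y = ∀ (W : Walk H x y) → d ≤ length H W

  Shortest : ∀ {x y} → Walk H x y → Set
  Shortest {x} {y} W = WalksAtLeast (length H W) x y

  shortest-if-≤ : ∀ {d x y} {W : Walk H x y} → WalksAtLeast d x y → length H W ≤ d → Shortest W
  shortest-if-≤ far W≤d W′ = ≤-trans W≤d (far W′)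

  walksAtLeast-prefix : ∀ {x y z} (U : Walk H x y) (W : Walk H y z) →
    Shortest (U ++ʷ W) → WalksAtLeast (length H U) x y
  walksAtLeast-prefix U W sh U′ =
    +-cancelʳ-≤ (length H W) (length H U) (length H U′)
      (subst₂ _≤_ (length-++ʷ U W) (length-++ʷ U′ W) (sh (U′ ++ʷ W)))

  walksAtLeast-from : ∀ {m k x y z} → WalkWithin m x y → WalksAtLeast (m + k) x z →
    WalksAtLeast k y z
  walksAtLeast-from {m} {k} (U , U≤m) far W =
    +-cancelˡ-≤ m k (length H W)
      (≤-trans (far (U ++ʷ W))
        (subst (_≤ m + length H W) (sym (length-++ʷ U W)) (+-monoˡ-≤ (length H W) U≤m)))

  walksAtLeast-to : ∀ {m k x y z} → WalkWithin m y z → WalksAtLeast (k + m) x z →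
    WalksAtLeast k x y
  walksAtLeast-to {m} {k} (U , U≤m) far W =
    +-cancelʳ-≤ m k (length H W)
      (≤-trans (far (W ++ʷ U))
        (subst (_≤ length H W + m) (sym (length-++ʷ W U)) (+-monoʳ-≤ (length H W) U≤m)))

  suffixWithin : ∀ {x y z} (W : Walk H x y) → z ∈ vertices H W → WalkWithin (length H W) z y
  suffixWithin []      (here refl) = [] , z≤n
  suffixWithin (s ∷ W) (here refl) = s ∷ W , ≤-refl
  suffixWithin (s ∷ W) (there z∈W) = map₂ m≤n⇒m≤1+n (suffixWithin W z∈W)

  shortest⇒isPath : ∀ {x y} (W : Walk H x y) → Shortest W → IsPath H W
  shortest⇒isPath []          sh = All.[] ∷ []
  shortest⇒isPath {x} (s ∷ W) sh =
    All.tabulate x∉W ∷ shortest⇒isPath W (λ W′ → ≤-pred (sh (s ∷ W′)))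
    where
    x∉W : ∀ {z} → z ∈ vertices H W → x ≢ z
    x∉W z∈W refl with suffixWithin W z∈W
    ... | W′ , W′≤W = <-irrefl refl (≤-trans (sh W′) W′≤W)

  shortest⇒isIsometric : ∀ {x y} (W : Walk H x y) → Shortest W → IsIsometric H W
  shortest⇒isIsometric W sh = shortest⇒isPath W sh , sh

module LineGraphWalks {n : ℕ} (G : SimpleGraph n) where
  open SimpleGraph G

  𝔾 : Graph
  𝔾 = toGraph G

  𝕃 : Graph
  𝕃 = LineGraph G

  open Walks 𝔾 public
  module L = Walks 𝕃

  _~_ : Fin n → Fin n → Set
  x ~ y = adj x y ≡ true

  edgeBetween : ∀ {a b} → a ~ b → Σ (Edge G) λ e → HasEnds G e a b
  edgeBetween {a} {b} a~b with <-cmp a b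
  ... | tri< a<b _ _ = edge a b a<b a~b , inj₁ (refl , refl)
  ... | tri≈ _ refl _ = ⊥-elim (Graph.~-irrefl 𝔾 a~b)
  ... | tri> _ _ b<a = edge b a b<a (Graph.~-sym 𝔾 a~b) , inj₂ (refl , refl)

  edgeOf : ∀ {a b} → a ~ b → Edge G
  edgeOf s = proj₁ (edgeBetween s)

  edgeOf-hasEnds : ∀ {a b} (s : a ~ b) → HasEnds G (edgeOf s) a b
  edgeOf-hasEnds s = proj₂ (edgeBetween s)

  hasEnds⇒incident : ∀ e {a b} → HasEnds G e a b → IncidentTo G a e × IncidentTo G b e
  hasEnds⇒incident _ (inj₁ (p , q)) = inj₁ (sym p) , inj₂ (sym q)
  hasEnds⇒incident _ (inj₂ (p , q)) = inj₂ (sym q) , inj₁ (sym p)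

  hasEnds-only : ∀ e {a b c} → HasEnds G e a b → IncidentTo G c e → c ≡ a ⊎ c ≡ b
  hasEnds-only _ (inj₁ (p , q)) (inj₁ r) = inj₁ (trans r p)
  hasEnds-only _ (inj₁ (p , q)) (inj₂ r) = inj₂ (trans r q)
  hasEnds-only _ (inj₂ (p , q)) (inj₁ r) = inj₂ (trans r p)
  hasEnds-only _ (inj₂ (p , q)) (inj₂ r) = inj₁ (trans r q)

  incident⇒hasEnds : ∀ e {a} → IncidentTo G a e → Σ (Fin n) (HasEnds G e a)
  incident⇒hasEnds e (inj₁ refl) = hi e , inj₁ (refl , refl)
  incident⇒hasEnds e (inj₂ refl) = lo e , inj₂ (refl , refl)

  startIncident : ∀ {a b} (s : a ~ b) → IncidentTo G a (edgeOf s)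
  startIncident s = proj₁ (hasEnds⇒incident (edgeOf s) (edgeOf-hasEnds s))

  endIncident : ∀ {a b} (s : a ~ b) → IncidentTo G b (edgeOf s)
  endIncident s = proj₂ (hasEnds⇒incident (edgeOf s) (edgeOf-hasEnds s))

  incident-walkWithin : ∀ e {a b} → IncidentTo G a e → IncidentTo G b e → WalkWithin 1 a b
  incident-walkWithin e (inj₁ refl) (inj₁ refl) = [] , z≤n
  incident-walkWithin e (inj₂ refl) (inj₂ refl) = [] , z≤n
  incident-walkWithin e (inj₁ refl) (inj₂ refl) = adjacent e ∷ [] , s≤s z≤n
  incident-walkWithin e (inj₂ refl) (inj₁ refl) = Graph.~-sym 𝔾 (adjacent e) ∷ [] , s≤s z≤n

  commonEnd : ∀ e f → ShareEnd G e f → Σ (Fin n) λ c → IncidentTo G c e × IncidentTo G c f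
  commonEnd e _ (inj₁ (inj₁ p)) = lo e , inj₁ refl , inj₁ p
  commonEnd e _ (inj₁ (inj₂ p)) = lo e , inj₁ refl , inj₂ p
  commonEnd e _ (inj₂ (inj₁ p)) = hi e , inj₂ refl , inj₁ p
  commonEnd e _ (inj₂ (inj₂ p)) = hi e , inj₂ refl , inj₂ p

  shareEnd : ∀ e f {c} → IncidentTo G c e → IncidentTo G c f → ShareEnd G e f
  shareEnd _ _ (inj₁ p) (inj₁ q) = inj₁ (inj₁ (trans (sym p) q))
  shareEnd _ _ (inj₁ p) (inj₂ q) = inj₁ (inj₂ (trans (sym p) q))
  shareEnd _ _ (inj₂ p) (inj₁ q) = inj₂ (inj₁ (trans (sym p) q))
  shareEnd _ _ (inj₂ p) (inj₂ q) = inj₂ (inj₂ (trans (sym p) q))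

  edge-≡ : ∀ {e f : Edge G} → lo e ≡ lo f → hi e ≡ hi f → e ≡ f
  edge-≡ {edge l h l<h l~h} {edge _ _ l<h′ l~h′} refl refl =
    cong₂ (edge l h) (<-irrelevant l<h l<h′) (Decidable⇒UIP.≡-irrelevant _≟ᵇ_ l~h l~h′)

  _≟ᴱ_ : (e f : Edge G) → Dec (e ≡ f)
  e ≟ᴱ f = map′ (uncurry edge-≡) (λ { refl → refl , refl }) ((lo e ≟ᶠ lo f) ×-dec (hi e ≟ᶠ hi f))

  lineStep⇒walk : ∀ {e g f} → Graph._~_ 𝕃 e g → (Q : Walk 𝕃 g f) →
    Σ (Fin n) λ a → Σ (Fin n) λ b →
      IncidentTo G a e × IncidentTo G b f × WalkWithin (length 𝕃 Q) a b
  lineStep⇒walk {e} {g} (_ , e∩g) [] with commonEnd e g e∩g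
  ... | c , c∈e , c∈g = c , c , c∈e , c∈g , [] , z≤n
  lineStep⇒walk {e} {g} (_ , e∩g) (s ∷ Q) with commonEnd e g e∩g | lineStep⇒walk s Q
  ... | c , c∈e , c∈g | a , b , a∈g , b∈f , W , W≤Q with incident-walkWithin g c∈g a∈g
  ... | C , C≤1 =
    c , b , c∈e , b∈f , C ++ʷ W ,
    subst (_≤ suc (length 𝕃 Q)) (sym (length-++ʷ C W)) (+-mono-≤ C≤1 W≤Q)

  line-walksAtLeast : ∀ {e f d} → e ≢ f →
    (∀ a b → IncidentTo G a e → IncidentTo G b f → WalksAtLeast d a b) →
    L.WalksAtLeast (suc d) e f
  line-walksAtLeast e≢f far []      = ⊥-elim (e≢f refl)
  line-walksAtLeast e≢f far (s ∷ Q) with lineStep⇒walk s Q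
  ... | a , b , a∈e , b∈f , W , W≤Q = s≤s (≤-trans (far a b a∈e b∈f W) W≤Q)

  lastEdge : ∀ {x y} → Edge G → Walk 𝔾 x y → Edge G
  lastEdge e []      = e
  lastEdge e (s ∷ W) = lastEdge (edgeOf s) W

  lastEdge-snoc : ∀ {x y z} (e : Edge G) (W : Walk 𝔾 x y) (s : y ~ z) →
    lastEdge e (W ++ʷ s ∷ []) ≡ edgeOf s
  lastEdge-snoc e []      s = refl
  lastEdge-snoc e (r ∷ W) s = lastEdge-snoc (edgeOf r) W s

  lastEdge-incident : ∀ {x y e} → IncidentTo G x e → (W : Walk 𝔾 x y) →
    IncidentTo G y (lastEdge e W)
  lastEdge-incident x∈e []      = x∈e
  lastEdge-incident x∈e (s ∷ W) = lastEdge-incident (endIncident s) W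

  lift : ∀ {x y} (e : Edge G) → IncidentTo G x e → (W : Walk 𝔾 x y) → Walk 𝕃 e (lastEdge e W)
  lift e x∈e []      = []
  lift e x∈e (s ∷ W) with e ≟ᴱ edgeOf s
  ... | yes refl = lift (edgeOf s) (endIncident s) W
  ... | no e≢s   = (e≢s , shareEnd e (edgeOf s) x∈e (startIncident s)) ∷ lift (edgeOf s) (endIncident s) W

  lift-length : ∀ {x y} (e : Edge G) (x∈e : IncidentTo G x e) (W : Walk 𝔾 x y) →
    length 𝕃 (lift e x∈e W) ≤ length 𝔾 W
  lift-length e x∈e []      = z≤n
  lift-length e x∈e (s ∷ W) with e ≟ᴱ edgeOf s
  ... | yes refl = m≤n⇒m≤1+n (lift-length (edgeOf s) (endIncident s) W)
  ... | no _     = s≤s (lift-length (edgeOf s) (endIncident s) W)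

  lift-length-merged : ∀ {x y z} (e : Edge G) (x∈e : IncidentTo G x e) (s : x ~ y)
    (W : Walk 𝔾 y z) → e ≡ edgeOf s → length 𝕃 (lift e x∈e (s ∷ W)) ≤ length 𝔾 W
  lift-length-merged e x∈e s W e≡s with e ≟ᴱ edgeOf s
  ... | yes refl = lift-length (edgeOf s) (endIncident s) W
  ... | no e≢s   = ⊥-elim (e≢s e≡s)

  lift-start : ∀ {x y} (e : Edge G) (x∈e : IncidentTo G x e) (W : Walk 𝔾 x y) →
    e ∈ vertices 𝕃 (lift e x∈e W)
  lift-start e x∈e []      = here refl
  lift-start e x∈e (s ∷ W) with e ≟ᴱ edgeOf s
  ... | yes refl = lift-start (edgeOf s) (endIncident s) W
  ... | no _     = here refl

  Covers : ∀ {e f x y} → Walk 𝕃 e f → Walk 𝔾 x y → Set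
  Covers Q W = ∀ a b → (a , b) ∈ edgePairs 𝔾 W →
    Σ (Edge G) λ e → HasEnds G e a b × e ∈ vertices 𝕃 Q

  lift-covers : ∀ {x y} (e : Edge G) (x∈e : IncidentTo G x e) (W : Walk 𝔾 x y) →
    Covers (lift e x∈e W) W
  lift-covers e x∈e (s ∷ W) a b ab∈W with e ≟ᴱ edgeOf s | ab∈W
  ... | yes refl | here refl = edgeOf s , edgeOf-hasEnds s , lift-start (edgeOf s) (endIncident s) W
  ... | yes refl | there ab∈W′ = lift-covers (edgeOf s) (endIncident s) W a b ab∈W′
  ... | no _     | here refl =
    edgeOf s , edgeOf-hasEnds s , there (lift-start (edgeOf s) (endIncident s) W)
  ... | no _     | there ab∈W′ = map₂ (map₂ there) (lift-covers (edgeOf s) (endIncident s) W a b ab∈W′)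

  covers-++ʳ : ∀ {e f x y z} {Q : Walk 𝕃 e f} (U : Walk 𝔾 x y) (W : Walk 𝔾 y z) →
    Covers Q (U ++ʷ W) → Covers Q W
  covers-++ʳ U W cov a b ab∈W =
    cov a b (subst ((a , b) ∈_) (sym (edgePairs-++ʷ U W)) (∈-++⁺ʳ (edgePairs 𝔾 U) ab∈W))

  walkWithin? : ∀ l a b → Dec (WalkWithin l a b)
  walkWithin? l a b with a ≟ᶠ b | l
  ... | yes refl | _     = yes ([] , z≤n)
  ... | no a≢b   | zero  = no λ { ([] , _) → a≢b refl ; (_ ∷ _ , ()) }
  ... | no a≢b   | suc k with any? (λ c → (adj a c ≟ᵇ true) ×-dec walkWithin? k c b)
  ...   | yes (c , s , W , W≤k) = yes (s ∷ W , s≤s W≤k)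
  ...   | no ¬step = no λ { ([] , _) → a≢b refl ; (s ∷ W , s≤s W≤k) → ¬step (_ , s , W , W≤k) }

module RootedCovers {n : ℕ} (G : SimpleGraph n) where
  open LineGraphWalks G

  CoveredBy : ∀ {e₀ f₁ f₂ u v} → Walk 𝔾 u v → Walk 𝕃 e₀ f₁ → Walk 𝕃 e₀ f₂ → Set
  CoveredBy P Q₁ Q₂ = ∀ (a b : Fin n) → (a , b) ∈ edgePairs 𝔾 P →
    Σ (Edge G) λ e → HasEnds G e a b × (e ∈ vertices 𝕃 Q₁ ⊎ e ∈ vertices 𝕃 Q₂)

  TwoRootedCover : ∀ {u v} → Edge G → Walk 𝔾 u v → Set
  TwoRootedCover e₀ P =
    Σ (Edge G) λ f₁ → Σ (Edge G) λ f₂ →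
    Σ (Walk 𝕃 e₀ f₁) λ Q₁ → Σ (Walk 𝕃 e₀ f₂) λ Q₂ →
    IsIsometric 𝕃 Q₁ × IsIsometric 𝕃 Q₂ × CoveredBy P Q₁ Q₂

  oneRootedCover : ∀ {e₀ f u v} {P : Walk 𝔾 u v} (Q : Walk 𝕃 e₀ f) →
    IsIsometric 𝕃 Q → Covers Q P → TwoRootedCover e₀ P
  oneRootedCover Q iso cov = _ , _ , Q , Q , iso , iso , λ a b ab∈P → map₂ (map₂ inj₁) (cov a b ab∈P)

  coveredBy-++ʷ : ∀ {e₀ f₁ f₂ x y z} {Q₁ : Walk 𝕃 e₀ f₁} {Q₂ : Walk 𝕃 e₀ f₂}
    (U : Walk 𝔾 x y) (W : Walk 𝔾 y z) → Covers Q₁ U → Covers Q₂ W → CoveredBy (U ++ʷ W) Q₁ Q₂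
  coveredBy-++ʷ U W cov₁ cov₂ a b ab∈UW
    with ∈-++⁻ (edgePairs 𝔾 U) (subst ((a , b) ∈_) (edgePairs-++ʷ U W) ab∈UW)
  ... | inj₁ ab∈U = map₂ (map₂ inj₁) (cov₁ a b ab∈U)
  ... | inj₂ ab∈W = map₂ (map₂ inj₂) (cov₂ a b ab∈W)

  module _ (e₀ : Edge G) {u w : Fin n} (e₀=uw : HasEnds G e₀ u w)
           {v : Fin n} (P : Walk 𝔾 u v) (P-shortest : Shortest P) where

    u∈e₀ : IncidentTo G u e₀
    u∈e₀ = proj₁ (hasEnds⇒incident e₀ e₀=uw)

    w∈e₀ : IncidentTo G w e₀
    w∈e₀ = proj₂ (hasEnds⇒incident e₀ e₀=uw)

    u→w : WalkWithin 1 u w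
    u→w = incident-walkWithin e₀ u∈e₀ w∈e₀

    walksAtLeast-split : ∀ {y} (A : Walk 𝔾 u y) (B : Walk 𝔾 y v) → A ++ʷ B ≡ P →
      WalksAtLeast (length 𝔾 A) u y
    walksAtLeast-split A B A·B≡P = walksAtLeast-prefix A B (subst Shortest (sym A·B≡P) P-shortest)

    rooted-isometric : ∀ {f d} (Q : Walk 𝕃 e₀ f) →
      (∀ b → IncidentTo G b f → WalksAtLeast (suc d) u b) → length 𝕃 Q ≤ suc d → IsIsometric 𝕃 Q
    rooted-isometric {f} {d} Q far Q≤ =
      L.shortest⇒isIsometric Q (L.shortest-if-≤ (line-walksAtLeast e₀≢f ends-far) Q≤)
      where
      e₀≢f : e₀ ≢ f
      e₀≢f refl with far u u∈e₀ []
      ... | ()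
      ends-far : ∀ a b → IncidentTo G a e₀ → IncidentTo G b f → WalksAtLeast d a b
      ends-far a b a∈e₀ b∈f with hasEnds-only e₀ e₀=uw a∈e₀
      ... | inj₁ refl = λ W → <⇒≤ (far b b∈f W)
      ... | inj₂ refl = walksAtLeast-from u→w (far b b∈f)

    prefixLift : ∀ {y x} (A : Walk 𝔾 u y) (t : y ~ x) → Walk 𝕃 e₀ (lastEdge e₀ (A ++ʷ t ∷ []))
    prefixLift A t = lift e₀ u∈e₀ (A ++ʷ t ∷ [])

    prefix-far : ∀ {y x} (A : Walk 𝔾 u y) (t : y ~ x) (B : Walk 𝔾 x v) → A ++ʷ t ∷ B ≡ P →
      WalksAtLeast (length 𝔾 A) u y × WalksAtLeast (suc (length 𝔾 A)) u x
    prefix-far A t B A·t·B≡P =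
      walksAtLeast-split A (t ∷ B) A·t·B≡P ,
      subst (λ d → WalksAtLeast d u _) (length-snoc A t)
        (walksAtLeast-split (A ++ʷ t ∷ []) B (trans (++ʷ-assoc A (t ∷ []) B) A·t·B≡P))

    -- e₀ can be the last edge of A · t only if A is empty, and lift then skips that step.
    prefixLift-merged-isometric : ∀ {x} (A : Walk 𝔾 u u) (t : u ~ x) → e₀ ≡ edgeOf t →
      WalksAtLeast (length 𝔾 A) u u → IsIsometric 𝕃 (prefixLift A t)
    prefixLift-merged-isometric [] t e₀≡t _ =
      L.shortest⇒isIsometric (prefixLift [] t)
        (L.shortest-if-≤ (λ _ → z≤n) (lift-length-merged e₀ u∈e₀ t [] e₀≡t))
    prefixLift-merged-isometric (s ∷ A) t e₀≡t u-far with u-far []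
    ... | ()

    prefixLift-isometric : ∀ {y x} (A : Walk 𝔾 u y) (t : y ~ x) (B : Walk 𝔾 x v) →
      A ++ʷ t ∷ B ≡ P → WalksAtLeast (length 𝔾 A) w y → IsIsometric 𝕃 (prefixLift A t)
    prefixLift-isometric A t B A·t·B≡P w-far with e₀ ≟ᴱ edgeOf t | prefix-far A t B A·t·B≡P
    ... | yes e₀≡t | u-y , u-x
      with hasEnds-only (edgeOf t) (edgeOf-hasEnds t) (subst (IncidentTo G u) e₀≡t u∈e₀)
    ...   | inj₁ refl = prefixLift-merged-isometric A t e₀≡t u-y
    ...   | inj₂ refl with u-x []
    ...     | ()
    prefixLift-isometric A t B A·t·B≡P w-far | no e₀≢t | u-y , u-x =
      L.shortest⇒isIsometric (prefixLift A t)
        (L.shortest-if-≤ (line-walksAtLeast (λ e₀≡f → e₀≢t (trans e₀≡f last≡t)) ends-far)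
          (subst (length 𝕃 (prefixLift A t) ≤_) (length-snoc A t)
            (lift-length e₀ u∈e₀ (A ++ʷ t ∷ []))))
      where
      last≡t : lastEdge e₀ (A ++ʷ t ∷ []) ≡ edgeOf t
      last≡t = lastEdge-snoc e₀ A t
      ends-far : ∀ a b → IncidentTo G a e₀ → IncidentTo G b (lastEdge e₀ (A ++ʷ t ∷ [])) →
        WalksAtLeast (length 𝔾 A) a b
      ends-far a b a∈e₀ b∈f
        with hasEnds-only e₀ e₀=uw a∈e₀
           | hasEnds-only (edgeOf t) (edgeOf-hasEnds t) (subst (IncidentTo G b) last≡t b∈f)
      ... | inj₁ refl | inj₁ refl = u-y
      ... | inj₁ refl | inj₂ refl = λ W → <⇒≤ (u-x W)
      ... | inj₂ refl | inj₁ refl = w-far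
      ... | inj₂ refl | inj₂ refl = walksAtLeast-from u→w u-x

    detourLift-isometric : ∀ {y x z} (A : Walk 𝔾 u y) (t : y ~ x) (t′ : x ~ z) (B : Walk 𝔾 z v) →
      A ++ʷ t ∷ t′ ∷ B ≡ P → (D : Walk 𝔾 w x) → length 𝔾 D ≤ length 𝔾 A →
      IsIsometric 𝕃 (lift e₀ w∈e₀ (D ++ʷ t′ ∷ B))
    detourLift-isometric A t t′ B A·t·t′·B≡P D D≤A =
      rooted-isometric (lift e₀ w∈e₀ (D ++ʷ t′ ∷ B)) last-far
        (≤-trans (lift-length e₀ w∈e₀ (D ++ʷ t′ ∷ B))
          (subst (_≤ suc (length 𝔾 A + length 𝔾 B))
            (sym (trans (length-++ʷ D (t′ ∷ B)) (+-suc (length 𝔾 D) (length 𝔾 B))))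
            (s≤s (+-monoˡ-≤ (length 𝔾 B) D≤A))))
      where
      lengthP : length 𝔾 P ≡ suc (length 𝔾 A + length 𝔾 B) + 1
      lengthP = begin
        length 𝔾 P                            ≡⟨ cong (length 𝔾) (sym A·t·t′·B≡P) ⟩
        length 𝔾 (A ++ʷ t ∷ t′ ∷ B)           ≡⟨ length-++ʷ A (t ∷ t′ ∷ B) ⟩
        length 𝔾 A + suc (suc (length 𝔾 B))   ≡⟨ +-suc (length 𝔾 A) (suc (length 𝔾 B)) ⟩
        suc (length 𝔾 A + suc (length 𝔾 B))   ≡⟨ cong suc (+-suc (length 𝔾 A) (length 𝔾 B)) ⟩
        suc (suc (length 𝔾 A + length 𝔾 B))   ≡⟨ +-comm 1 (suc (length 𝔾 A + length 𝔾 B)) ⟩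
        suc (length 𝔾 A + length 𝔾 B) + 1     ∎
        where open ≡-Reasoning
      last-far : ∀ b → IncidentTo G b (lastEdge e₀ (D ++ʷ t′ ∷ B)) →
        WalksAtLeast (suc (length 𝔾 A + length 𝔾 B)) u b
      last-far b b∈f =
        walksAtLeast-to
          (incident-walkWithin (lastEdge e₀ (D ++ʷ t′ ∷ B)) b∈f (lastEdge-incident w∈e₀ (D ++ʷ t′ ∷ B)))
          (subst (λ d → WalksAtLeast d u v) lengthP P-shortest)

    -- Walks along P = A · t · B to the first x with d(w, x) ≤ |A| = d(u, x) − 1.
    scan : ∀ {y x} (A : Walk 𝔾 u y) (t : y ~ x) (B : Walk 𝔾 x v) → A ++ʷ t ∷ B ≡ P →
      WalksAtLeast (length 𝔾 A) w y → TwoRootedCover e₀ P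
    scan A t [] A·t≡P w-far =
      oneRootedCover (prefixLift A t) (prefixLift-isometric A t [] A·t≡P w-far)
        (subst (Covers (prefixLift A t)) A·t≡P (lift-covers e₀ u∈e₀ (A ++ʷ t ∷ [])))
    scan {x = x} A t (t′ ∷ B) A·t·t′·B≡P w-far with walkWithin? (length 𝔾 A) w x
    ... | yes (D , D≤A) =
      _ , _ , prefixLift A t , lift e₀ w∈e₀ (D ++ʷ t′ ∷ B) ,
      prefixLift-isometric A t (t′ ∷ B) A·t·t′·B≡P w-far ,
      detourLift-isometric A t t′ B A·t·t′·B≡P D D≤A ,
      subst (λ W → CoveredBy W (prefixLift A t) (lift e₀ w∈e₀ (D ++ʷ t′ ∷ B))) A·t·[t′·B]≡P
        (coveredBy-++ʷ (A ++ʷ t ∷ []) (t′ ∷ B) (lift-covers e₀ u∈e₀ (A ++ʷ t ∷ []))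
          (covers-++ʳ D (t′ ∷ B) (lift-covers e₀ w∈e₀ (D ++ʷ t′ ∷ B))))
      where
      A·t·[t′·B]≡P : (A ++ʷ t ∷ []) ++ʷ t′ ∷ B ≡ P
      A·t·[t′·B]≡P = trans (++ʷ-assoc A (t ∷ []) (t′ ∷ B)) A·t·t′·B≡P
    ... | no ¬D =
      scan (A ++ʷ t ∷ []) t′ B (trans (++ʷ-assoc A (t ∷ []) (t′ ∷ B)) A·t·t′·B≡P) w-far′
      where
      w-far′ : WalksAtLeast (length 𝔾 (A ++ʷ t ∷ [])) w x
      w-far′ W = subst (_≤ length 𝔾 W) (sym (length-snoc A t)) (≰⇒> λ W≤A → ¬D (W , W≤A))

open RootedCovers using (scan)

lemma4p7 : ∀ {n : ℕ} (G : SimpleGraph n) (u v : Fin n)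
    (P : Walk (toGraph G) u v) → IsIsometric (toGraph G) P →
    (e₀ : Edge G) → IncidentTo G u e₀ →
    Σ (Edge G) λ f₁ → Σ (Edge G) λ f₂ →
    Σ (Walk (LineGraph G) e₀ f₁) λ Q₁ → Σ (Walk (LineGraph G) e₀ f₂) λ Q₂ →
    IsIsometric (LineGraph G) Q₁ × IsIsometric (LineGraph G) Q₂ ×
    (∀ (a b : Fin n) → (a , b) ∈ edgePairs (toGraph G) P →
      Σ (Edge G) λ e → HasEnds G e a b ×
        (e ∈ vertices (LineGraph G) Q₁ ⊎ e ∈ vertices (LineGraph G) Q₂))
lemma4p7 G u v [] _ e₀ _ =
  e₀ , e₀ , [] , [] , trivial , trivial , λ _ _ ()
  where
  trivial : IsIsometric (LineGraph G) {e₀} {e₀} []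
  trivial = Walks.shortest⇒isIsometric (LineGraph G) [] (λ _ → z≤n)
lemma4p7 G u v (t ∷ B) (_ , P-shortest) e₀ u∈e₀ with LineGraphWalks.incident⇒hasEnds G e₀ u∈e₀
... | w , e₀=uw = scan G e₀ e₀=uw (t ∷ B) P-shortest [] t B refl (λ _ → z≤n)
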